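{- Let $k$ be a positive integer, let $G$ be a $k$-critical graph on $n$ vertices, let $X\subseteq V(G)$ have size $s$, and let $T$ be a DFS spanning tree of $G\setminus X$ rooted at a vertex $t_0$. Then for every integer $j\ge 1$ the number of vertices of $T$ at distance exactly $j$ from $t_0$ (in $T$) is at most $(k-1)^s$ if $j=1$, and at most $(k-2)^{j-2}(k-1)^s$ if $j\ge 2$.
   Context: All graphs are finite and simple. A graph $G$ is $k$-critical if $G$ is not $(k-1)$-colorable but every proper subgraph of $G$ is $(k-1)$-colorable. $G\setminus X$ is the graph obtained by deleting the vertices of $X$. For a tree $T$ and $x,y\in V(T)$, $xTy$ denotes the unique path in $T$ between $x$ and $y$. A spanning tree $T$ of a graph $H$ is a DFS spanning tree rooted at $v$ if for every edge $xy\in E(H)$ either $x\in V(vTy)$ or $y\in V(vTx)$. Convention $0^0=1$. -}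

module Defs where

open import Data.Nat using (ℕ; suc; _≤_)
open import Data.Fin using (Fin)
open import Data.Fin.Subset using (Subset; _∈_; _∉_; ∣_∣)
open import Data.Bool using (Bool; true; false)
open import Data.List using (List; []; _∷_; length)
import Data.List.Membership.Propositional as LM
open import Data.List.Relation.Unary.Unique.Propositional using (Unique)
open import Data.Product using (Σ; ∃; ∃-syntax; _×_)
open import Data.Sum using (_⊎_)
open import Relation.Binary.PropositionalEquality using (_≡_; _≢_)
open import Relation.Nullary using (¬_)
import Data.Empty

record Graph (n : ℕ) : Set where
  field
    adj     : Fin n → Fin n → Bool
    adj-sym : ∀ u v → adj u v ≡ adj v u
    irrefl  : ∀ u → adj u u ≡ false
open Graph public

record Subgraph {n : ℕ} (G : Graph n) : Set where
  field
    V     : Fin n → Bool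
    E     : Fin n → Fin n → Bool
    E-sym : ∀ u v → E u v ≡ E v u
    E⊆    : ∀ u v → E u v ≡ true → adj G u v ≡ true
    E-V   : ∀ u v → E u v ≡ true → V u ≡ true × V v ≡ true
open Subgraph public

whole : ∀ {n} (G : Graph n) → Subgraph G
whole G = record
  { V = λ _ → true ; E = adj G ; E-sym = adj-sym G
  ; E⊆ = λ _ _ e → e ; E-V = λ _ _ _ → _≡_.refl , _≡_.refl }
  where open import Data.Product using (_,_)

Proper : ∀ {n} {G : Graph n} → Subgraph G → Set
Proper {n} {G} H =
  (∃[ v ] V H v ≡ false) ⊎ (∃[ u ] ∃[ v ] (adj G u v ≡ true × E H u v ≡ false))

Colorable : ∀ {n} {G : Graph n} → ℕ → Subgraph G → Set
Colorable {n} m H =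
  Σ ((u : Fin n) → V H u ≡ true → Fin m) λ c →
    ∀ u v (pu : V H u ≡ true) (pv : V H v ≡ true) →
      E H u v ≡ true → c u pu ≢ c v pv

Critical : ∀ {n} → ℕ → Graph n → Set
Critical k G =
  ¬ Colorable (k Data.Nat.∸ 1) (whole G) ×
  (∀ (H : Subgraph G) → Proper H → Colorable (k Data.Nat.∸ 1) H)

data Walk {n : ℕ} (E : Fin n → Fin n → Bool) : Fin n → Fin n → List (Fin n) → Set where
  here : ∀ {x} → Walk E x x (x ∷ [])
  step : ∀ {x y z P} → E x y ≡ true → Walk E y z P → Walk E x z (x ∷ P)

Path : ∀ {n} → (Fin n → Fin n → Bool) → Fin n → Fin n → List (Fin n) → Set
Path E x y P = Walk E x y P × Unique P

delE : ∀ {n} → Graph n → Subset n → Fin n → Fin n → Set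
delE G X u v = u ∉ X × v ∉ X × adj G u v ≡ true

record SpanningTree {n : ℕ} (G : Graph n) (X : Subset n) (ET : Fin n → Fin n → Bool) : Set where
  field
    ET-sym : ∀ u v → ET u v ≡ ET v u
    ET⊆    : ∀ u v → ET u v ≡ true → delE G X u v
    conn   : ∀ u v → u ∉ X → v ∉ X → ∃[ P ] Path ET u v P
    acyc   : ∀ x y P → Path ET x y P → 3 ≤ length P → ET y x ≡ true → Data.Empty.⊥
open SpanningTree public

record DFSTree {n : ℕ} (G : Graph n) (X : Subset n) (ET : Fin n → Fin n → Bool) (t0 : Fin n) : Set where
  field
    spanning : SpanningTree G X ET
    root     : t0 ∉ X
    dfs      : ∀ x y → delE G X x y →
                 (∀ P → Path ET t0 y P → x LM.∈ P) ⊎ (∀ Q → Path ET t0 x Q → y LM.∈ Q)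

AtDist : ∀ {n} → (Fin n → Fin n → Bool) → Fin n → ℕ → Fin n → Set
AtDist ET t0 j v = ∃[ P ] (Path ET t0 v P × length P ≡ suc j)

module Submission where

-- For a tree vertex w let D(w) be its set of descendants.  As G is
-- k-critical, G − D(w) has a proper (k−1)-colouring ρ_w.  Exchange argument:
-- if w ≠ w' have the same depth and ρ_w, ρ_w' agree on X and position by
-- position along the root paths t0Tw, t0Tw' (last vertex excluded), let
-- d ≠ d' be where these paths diverge; recolouring D(d) by ρ_w' gives a
-- proper (k−1)-colouring of G, because by the DFS property every edge
-- leaving D(d) ends in X or on the common part of the two paths.  So w is
-- determined by these colours.  Normalising so that t0 (and t1) get fixed
-- colours leaves (k−1)^s choices on X and k−2 choices at each further
-- coloured path vertex.

open import Defs
open import Data.Nat using (ℕ; zero; suc; _≤_; _∸_; _*_; _^_; z≤n; s≤s)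
open import Data.Nat.Properties using (suc-injective)
open import Data.Fin using (Fin; zero; suc; combine; punchOut)
open import Data.Fin.Properties using (_≟_; combine-injective; punchOut-injective; injective⇒≤; ¬Fin0)
open import Data.Fin.Permutation.Components using (transpose; transpose-inverse)
open import Data.Vec.Base using ([]; _∷_) renaming (there to thereᵥ)
open import Data.Fin.Subset using (Subset; ∣_∣) renaming (_∈_ to _∈ₛ_; _∉_ to _∉ₛ_)
open import Data.Fin.Subset.Properties using () renaming (_∈?_ to _∈ₛ?_)
open import Data.Bool using (Bool; true; false; not; _∧_; if_then_else_)
open import Data.Bool.Properties using (∧-comm)
open import Data.List using (List; []; _∷_; length; _++_; [_]; lookup)
open import Data.List.Properties using (++-assoc)
open import Data.List.Membership.Propositional using (_∈_; _∉_)
open import Data.List.Membership.Propositional.Properties using (∈-++⁺ˡ; ∈-++⁺ʳ; ∈-++⁻; ∈-∃++; ∈-lookup)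
import Data.List.Membership.DecPropositional as DecMembership
open import Data.List.Relation.Unary.Any using (here; there)
open import Data.List.Relation.Unary.All as All using (All; []; _∷_)
open import Data.List.Relation.Unary.All.Properties using (++⁻ˡ; ++⁻ʳ; ++⁺)
open import Data.List.Relation.Unary.AllPairs using ([]; _∷_)
open import Data.List.Relation.Unary.Unique.Propositional using (Unique)
open import Data.Product using (Σ; ∃-syntax; _×_; _,_; proj₁; proj₂)
open import Data.Sum using (_⊎_; inj₁; inj₂; map₁; [_,_]′)
open import Data.Empty using (⊥; ⊥-elim)
open import Data.Unit using (⊤; tt)
open import Function using (_∘_)
open import Relation.Nullary using (¬_; Dec; yes; no; does)
open import Relation.Nullary.Decidable using (dec-true; dec-false; map′)
open import Relation.Binary.PropositionalEquality hiding ([_])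

module ListFacts {A : Set} where

  ∈-prefix⁺ : ∀ B {v C} {z : A} → z ∈ B ++ [ v ] → z ∈ B ++ v ∷ C
  ∈-prefix⁺ B z∈ with ∈-++⁻ B z∈
  ... | inj₁ z∈B          = ∈-++⁺ˡ z∈B
  ... | inj₂ (here refl)  = ∈-++⁺ʳ B (here refl)

  unique-prefix : ∀ B {v C} → Unique {A = A} (B ++ v ∷ C) → Unique (B ++ [ v ])
  unique-prefix []      _         = [] ∷ []
  unique-prefix (_ ∷ B) (b∉ ∷ u) = ++⁺ (++⁻ˡ B b∉) (All.head (++⁻ʳ B b∉) ∷ []) ∷ unique-prefix B u

  unique-disjoint : ∀ B {C} {x : A} → Unique (B ++ C) → x ∈ B → x ∈ C → ⊥
  unique-disjoint (_ ∷ B) (b∉ ∷ _) (here refl) x∈C = All.lookup b∉ (∈-++⁺ʳ B x∈C) refl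
  unique-disjoint (_ ∷ B) (_ ∷ u)  (there x∈B) x∈C = unique-disjoint B u x∈B x∈C

  unique-∉-sibling : ∀ B {d R d'} → Unique {A = A} (B ++ d ∷ R) → d ≢ d' → d ∉ B ++ [ d' ]
  unique-∉-sibling B u d≢d' d∈ with ∈-++⁻ B d∈
  ... | inj₁ d∈B          = unique-disjoint B u d∈B (here refl)
  ... | inj₂ (here d≡d')  = d≢d' d≡d'

  first-divergence : (_≟ₐ_ : (x y : A) → Dec (x ≡ y)) (P P' : List A) →
    length P ≡ length P' → P ≢ P' →
    ∃[ B ] ∃[ d ] ∃[ R ] ∃[ d' ] ∃[ R' ] (P ≡ B ++ d ∷ R × P' ≡ B ++ d' ∷ R' × d ≢ d')
  first-divergence _≟ₐ_ [] [] _ P≢P' = ⊥-elim (P≢P' refl)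
  first-divergence _≟ₐ_ (x ∷ P) (x' ∷ P') |P|≡|P'| P≢P' with x ≟ₐ x'
  ... | no x≢x' = [] , x , P , x' , P' , refl , refl , x≢x'
  ... | yes refl with first-divergence _≟ₐ_ P P' (suc-injective |P|≡|P'|) (P≢P' ∘ cong (x ∷_))
  ...   | B , d , R , d' , R' , refl , refl , d≢d' = x ∷ B , d , R , d' , R' , refl , refl , d≢d'

open ListFacts

module Walks {n : ℕ} (E : Fin n → Fin n → Bool) (E-sym : ∀ u v → E u v ≡ E v u) where

  open DecMembership (_≟_ {n}) using (_∈?_)

  walk-head : ∀ {x y h L} → Walk E x y (h ∷ L) → h ≡ x
  walk-head here       = refl
  walk-head (step _ _) = refl

  start∈walk : ∀ {x y L} → Walk E x y L → x ∈ L
  start∈walk here       = here refl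
  start∈walk (step _ _) = here refl

  end∈walk : ∀ {x y L} → Walk E x y L → y ∈ L
  end∈walk here       = here refl
  end∈walk (step _ w) = there (end∈walk w)

  end∈suffix : ∀ {x y} B {d R} → Walk E x y (B ++ d ∷ R) → y ∈ d ∷ R
  end∈suffix []          w          = end∈walk w
  end∈suffix (_ ∷ [])    (step _ w) = end∈walk w
  end∈suffix (_ ∷ b ∷ B) (step _ w) = end∈suffix (b ∷ B) w

  walk-edge : ∀ {x y} B {a b R} → Walk E x y (B ++ a ∷ b ∷ R) → E a b ≡ true
  walk-edge []          (step e w) with walk-head w
  ... | refl = e
  walk-edge (_ ∷ [])    (step _ w) = walk-edge [] w
  walk-edge (_ ∷ b ∷ B) (step _ w) = walk-edge (b ∷ B) w

  walk-origin-determined : ∀ {x y x' y' L} → Walk E x y L → Walk E x' y' L → x ≡ x'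
  walk-origin-determined here       here       = refl
  walk-origin-determined here       (step _ _) = refl
  walk-origin-determined (step _ _) here       = refl
  walk-origin-determined (step _ _) (step _ _) = refl

  walk-end-determined : ∀ {x y y' L} → Walk E x y L → Walk E x y' L → y ≡ y'
  walk-end-determined here       here         = refl
  walk-end-determined here       (step _ ())
  walk-end-determined (step _ ()) here
  walk-end-determined (step _ w) (step _ w') with walk-origin-determined w w'
  ... | refl = walk-end-determined w w'

  walk-++ : ∀ {a y b P Q} → Walk E a y P → Walk E y b Q →
            ∃[ L ] (Walk E a b L × (∀ {v} → v ∈ L → v ∈ P ⊎ v ∈ Q))
  walk-++ here       w' = _ , w' , inj₂
  walk-++ (step e w) w' with walk-++ w w'
  ... | L , wL , L⊆ = _ , step e wL , λ { (here refl) → inj₁ (here refl)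
                                        ; (there v∈L) → map₁ there (L⊆ v∈L) }

  walk-reverse : ∀ {a b P} → Walk E a b P → ∃[ L ] (Walk E b a L × (∀ {v} → v ∈ L → v ∈ P))
  walk-reverse here = _ , here , λ v∈ → v∈
  walk-reverse {a} (step {y = y} e w) with walk-reverse w
  ... | L , wL , L⊆ with walk-++ wL (step (trans (E-sym y a) e) here)
  ...   | L₂ , wL₂ , L₂⊆ = L₂ , wL₂ , back ∘ L₂⊆
    where
    back : ∀ {v} → v ∈ L ⊎ v ∈ y ∷ a ∷ [] → v ∈ a ∷ _
    back (inj₁ v∈L)                = there (L⊆ v∈L)
    back (inj₂ (here refl))        = there (start∈walk w)
    back (inj₂ (there (here refl))) = here refl

  path-from : ∀ {y b R a} → Walk E y b R → Unique R → a ∈ R →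
              ∃[ S ] (Path E a b S × (∀ {v} → v ∈ S → v ∈ R))
  path-from here       u       (here refl) = _ , (here , u) , λ v∈ → v∈
  path-from (step e w) u       (here refl) = _ , (step e w , u) , λ v∈ → v∈
  path-from (step _ w) (_ ∷ u) (there a∈R) with path-from w u a∈R
  ... | S , pS , S⊆ = S , pS , there ∘ S⊆

  -- Every walk can be shortened to a path through a subset of its vertices:
  -- if the first vertex recurs later, continue from that occurrence.
  walk⇒path : ∀ {a b W} → Walk E a b W → ∃[ R ] (Path E a b R × (∀ {v} → v ∈ R → v ∈ W))
  walk⇒path here = _ , (here , [] ∷ []) , λ v∈ → v∈
  walk⇒path {a} (step e w) with walk⇒path w
  ... | R , (wR , uR) , R⊆ with a ∈? R
  ...   | no a∉R =
    _ , (step e wR , All.tabulate (λ v∈R a≡v → a∉R (subst (_∈ R) (sym a≡v) v∈R)) ∷ uR) ,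
    λ { (here refl) → here refl ; (there v∈R) → there (R⊆ v∈R) }
  ...   | yes a∈R with path-from wR uR a∈R
  ...     | S , pS , S⊆ = S , pS , there ∘ R⊆ ∘ S⊆

  walk-prefix : ∀ {x y} B {v C} → Walk E x y (B ++ v ∷ C) → Walk E x v (B ++ [ v ])
  walk-prefix []          w with walk-head w
  ... | refl = here
  walk-prefix (_ ∷ [])    (step e w) with walk-head w
  ... | refl = step e here
  walk-prefix (_ ∷ b ∷ B) (step e w) = step e (walk-prefix (b ∷ B) w)

  path-prefix : ∀ {x y} B {v C} → Path E x y (B ++ v ∷ C) → Path E x v (B ++ [ v ])
  path-prefix B (w , u) = walk-prefix B w , unique-prefix B u

module DFS {n : ℕ} (G : Graph n) (X : Subset n) (ET : Fin n → Fin n → Bool) (t0 : Fin n)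
           (dfs-tree : DFSTree G X ET t0) where

  open DFSTree dfs-tree using (spanning; root; dfs)
  open Walks ET (ET-sym spanning) public
  open DecMembership (_≟_ {n}) using (_∈?_)

  walk-avoids-X : ∀ {x y L v} → Walk ET x y L → x ∉ₛ X → v ∈ L → v ∉ₛ X
  walk-avoids-X here       x∉X (here refl)  = x∉X
  walk-avoids-X (step _ _) x∉X (here refl)  = x∉X
  walk-avoids-X (step e w) _   (there v∈L) = walk-avoids-X w (proj₁ (proj₂ (ET⊆ spanning _ _ e))) v∈L

  tree-edge-in-G : ∀ {x y} B {a b R} → Walk ET x y (B ++ a ∷ b ∷ R) → adj G a b ≡ true
  tree-edge-in-G B w = proj₂ (proj₂ (ET⊆ spanning _ _ (walk-edge B w)))

  distinct-ends⇒≥2 : ∀ {a b R} → Walk ET a b R → a ≢ b → 2 ≤ length R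
  distinct-ends⇒≥2 here              a≢b = ⊥-elim (a≢b refl)
  distinct-ends⇒≥2 (step _ here)     _   = s≤s (s≤s z≤n)
  distinct-ends⇒≥2 (step _ (step _ _)) _ = s≤s (s≤s z≤n)

  -- T is acyclic, so any two vertices are joined by at most one path in T:
  -- two different first steps would close a cycle through x.
  tree-path-unique : ∀ {x y P Q} → Path ET x y P → Path ET x y Q → P ≡ Q
  tree-path-unique (here , _) (here , _) = refl
  tree-path-unique (here , _) (step _ w , (x∉ ∷ _)) = ⊥-elim (All.lookup x∉ (end∈walk w) refl)
  tree-path-unique (step _ w , (x∉ ∷ _)) (here , _) = ⊥-elim (All.lookup x∉ (end∈walk w) refl)
  tree-path-unique {x} (step {y = a} e w , (x∉P ∷ uP)) (step {y = b} e' w' , (x∉Q ∷ uQ)) with a ≟ b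
  ... | yes refl = cong (x ∷_) (tree-path-unique (w , uP) (w' , uQ))
  ... | no a≢b with walk-reverse w'
  ...   | L₁ , wL₁ , L₁⊆ with walk-++ w wL₁
  ...     | L₂ , wL₂ , L₂⊆ with walk⇒path wL₂
  ...       | R , (wR , uR) , R⊆ =
    ⊥-elim (acyc spanning x b (x ∷ R) (step e wR , (All.tabulate x∉R ∷ uR))
         (s≤s (distinct-ends⇒≥2 wR a≢b)) (trans (ET-sym spanning b x) e'))
    where
    x∉R : ∀ {v} → v ∈ R → x ≢ v
    x∉R v∈R with L₂⊆ (R⊆ v∈R)
    ... | inj₁ v∈P = All.lookup x∉P v∈P
    ... | inj₂ v∈L₁ = All.lookup x∉Q (L₁⊆ v∈L₁)

  root-path : ∀ v → v ∉ₛ X → List (Fin n)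
  root-path v v∉X = proj₁ (conn spanning t0 v root v∉X)

  root-path-ok : ∀ v (v∉X : v ∉ₛ X) → Path ET t0 v (root-path v v∉X)
  root-path-ok v v∉X = proj₂ (conn spanning t0 v root v∉X)

  initial-root-path : ∀ {y} B {v C Pv} → Path ET t0 y (B ++ v ∷ C) → Path ET t0 v Pv →
                      Pv ≡ B ++ [ v ]
  initial-root-path B p pv = tree-path-unique pv (path-prefix B p)

  ancestor-path⊆ : ∀ {y v z P Pv} → Path ET t0 y P → v ∈ P → Path ET t0 v Pv → z ∈ Pv → z ∈ P
  ancestor-path⊆ p v∈P pv z∈Pv with ∈-∃++ v∈P
  ... | B , C , refl = ∈-prefix⁺ B (subst (_ ∈_) (initial-root-path B p pv) z∈Pv)

  ancestors-comparable : ∀ {y a b P Pa Pb} → Path ET t0 y P → a ∈ P → b ∈ P →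
                         Path ET t0 a Pa → Path ET t0 b Pb → b ∈ Pa ⊎ a ∈ Pb
  ancestors-comparable {a = a} {b} p a∈P b∈P pa pb with ∈-∃++ a∈P
  ... | B , C , refl with ∈-++⁻ B b∈P
  ...   | inj₁ b∈B          = inj₁ (subst (b ∈_) (sym (initial-root-path B p pa)) (∈-++⁺ˡ b∈B))
  ...   | inj₂ (here refl)  = inj₁ (end∈walk (proj₁ pa))
  ...   | inj₂ (there b∈C) with ∈-∃++ b∈C
  ...     | C₁ , C₂ , refl =
    inj₂ (subst (a ∈_) (sym (initial-root-path (B ++ a ∷ C₁) p' pb)) (∈-++⁺ˡ (∈-++⁺ʳ B (here refl))))
    where
    p' : Path ET t0 _ ((B ++ a ∷ C₁) ++ b ∷ C₂)
    p' = subst (Path ET t0 _) (sym (++-assoc B (a ∷ C₁) (b ∷ C₂))) p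

  ancestors-antisym : ∀ {a b Pa Pb} → Path ET t0 a Pa → Path ET t0 b Pb → a ∈ Pb → b ∈ Pa → a ≡ b
  ancestors-antisym pa pb a∈Pb b∈Pa with ∈-∃++ a∈Pb
  ... | B , C , refl with ∈-++⁻ B (subst (_ ∈_) (initial-root-path B pb pa) b∈Pa)
  ...   | inj₂ (here refl) = refl
  ...   | inj₁ b∈B = ⊥-elim (unique-disjoint B (proj₂ pb) b∈B (end∈suffix B (proj₁ pb)))

  Desc : Fin n → Fin n → Set
  Desc d u = u ∉ₛ X × (∀ Q → Path ET t0 u Q → d ∈ Q)

  desc-intro : ∀ {d u Q} → Path ET t0 u Q → d ∈ Q → Desc d u
  desc-intro q d∈Q =
    walk-avoids-X (proj₁ q) root (end∈walk (proj₁ q)) ,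
    λ Q' q' → subst (_ ∈_) (tree-path-unique q q') d∈Q

  desc-self : ∀ {w P} → Path ET t0 w P → Desc w w
  desc-self p = desc-intro p (end∈walk (proj₁ p))

  desc? : ∀ d u → Dec (Desc d u)
  desc? d u with u ∈ₛ? X
  ... | yes u∈X = no (λ (u∉X , _) → u∉X u∈X)
  ... | no u∉X  = map′ (desc-intro (root-path-ok u u∉X)) (λ (_ , d-on) → d-on _ (root-path-ok u u∉X))
                       (d ∈? root-path u u∉X)

  desc-trans : ∀ {w Pw d u} → Path ET t0 w Pw → d ∈ Pw → Desc w u → Desc d u
  desc-trans pw d∈Pw (u∉X , w-on) = u∉X , λ Q q → ancestor-path⊆ q (w-on Q q) pw d∈Pw

  ancestor-not-desc : ∀ {w} A {d R v} → Path ET t0 w (A ++ d ∷ R) → v ∈ A → ¬ Desc w v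
  ancestor-not-desc {w} A {v = v} pw v∈A (v∉X , w-on) =
    unique-disjoint A (proj₂ pw) v∈A (subst (_∈ _) w≡v (end∈suffix A (proj₁ pw)))
    where
    pv : Path ET t0 v (root-path v v∉X)
    pv = root-path-ok v v∉X
    w≡v : w ≡ v
    w≡v = ancestors-antisym pw pv (w-on _ pv) (∈-++⁺ˡ v∈A)

  exit-to-ancestor : ∀ {d u v Pd} → Path ET t0 d Pd → Desc d u → ¬ Desc d v → v ∉ₛ X →
                     adj G u v ≡ true → v ∈ Pd × v ≢ d
  exit-to-ancestor {d} {u} {v} {Pd} pd (u∉X , d-on) v∉Dd v∉X uv = exit (dfs u v (u∉X , v∉X , uv))
    where
    pu : Path ET t0 u (root-path u u∉X)
    pu = root-path-ok u u∉X
    pv : Path ET t0 v (root-path v v∉X)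
    pv = root-path-ok v v∉X
    exit : (∀ P → Path ET t0 v P → u ∈ P) ⊎ (∀ Q → Path ET t0 u Q → v ∈ Q) → v ∈ Pd × v ≢ d
    exit (inj₁ u-on) = ⊥-elim (v∉Dd (desc-trans pu (d-on _ pu) (v∉X , u-on)))
    exit (inj₂ v-on) with ancestors-comparable pu (d-on _ pu) (v-on _ pu) pd pv
    ... | inj₁ v∈Pd = v∈Pd , λ v≡d → v∉Dd (subst (Desc d) (sym v≡d) (desc-self pd))
    ... | inj₂ d∈Pv = ⊥-elim (v∉Dd (desc-intro pv d∈Pv))

  diverging-subtrees-disjoint : ∀ {y y'} A {d R d' R' u} → Path ET t0 y (A ++ d ∷ R) →
    Path ET t0 y' (A ++ d' ∷ R') → d ≢ d' → Desc d u → Desc d' u → ⊥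
  diverging-subtrees-disjoint A {u = u} p p' d≢d' (u∉X , d-on) (_ , d'-on) =
    [ unique-∉-sibling A (proj₂ p') (≢-sym d≢d') , unique-∉-sibling A (proj₂ p) d≢d' ]′
      (ancestors-comparable pu (d-on _ pu) (d'-on _ pu) (path-prefix A p) (path-prefix A p'))
    where
    pu : Path ET t0 u (root-path u u∉X)
    pu = root-path-ok u u∉X

-- Two colourings agree along two lists, position by position, the last
-- position excluded (the last vertex of a root path of w lies in D(w),
-- where the colourings of G − D(w) carry no information).
AgreeAlong : ∀ {V : Set} {M} (ρ ρ' : V → Fin M) → List V → List V → Set
AgreeAlong ρ ρ' (x ∷ y ∷ l) (x' ∷ y' ∷ l') = ρ x ≡ ρ' x' × AgreeAlong ρ ρ' (y ∷ l) (y' ∷ l')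
AgreeAlong ρ ρ' _           _               = ⊤

agree-before-divergence : ∀ {V : Set} {M} {ρ ρ' : V → Fin M} A {d R d' R' v} →
  AgreeAlong ρ ρ' (A ++ d ∷ R) (A ++ d' ∷ R') → v ∈ A → ρ v ≡ ρ' v
agree-before-divergence (_ ∷ [])    (ρa≡ρ'a , _) (here refl)  = ρa≡ρ'a
agree-before-divergence (_ ∷ _ ∷ _) (ρa≡ρ'a , _) (here refl)  = ρa≡ρ'a
agree-before-divergence (_ ∷ b ∷ A) (_ , agree)  (there v∈A) = agree-before-divergence (b ∷ A) agree v∈A

module Exchange {n : ℕ} (G : Graph n) (X : Subset n) (ET : Fin n → Fin n → Bool) (t0 : Fin n)
                (dfs-tree : DFSTree G X ET t0) where

  open DFS G X ET t0 dfs-tree public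

  -- ρ is a proper colouring of G − D(w), extended arbitrarily to D(w).
  ProperOutside : ∀ {M} → Fin n → (Fin n → Fin M) → Set
  ProperOutside w ρ = ∀ u v → ¬ Desc w u → ¬ Desc w v → adj G u v ≡ true → ρ u ≢ ρ v

  module Glue {M w w'} A {d R d' R'} {ρ ρ' : Fin n → Fin M}
              (p : Path ET t0 w (A ++ d ∷ R)) (p' : Path ET t0 w' (A ++ d' ∷ R')) (d≢d' : d ≢ d')
              (proper : ProperOutside w ρ) (proper' : ProperOutside w' ρ')
              (agree-X : ∀ x → x ∈ₛ X → ρ x ≡ ρ' x) (agree-A : ∀ {v} → v ∈ A → ρ v ≡ ρ' v) where

    ψ : Fin n → Fin M
    ψ u = if does (desc? d u) then ρ' u else ρ u

    -- D(d) misses D(w'), and D(w) ⊆ D(d): each colouring is used where it is proper.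
    inside : ∀ {u} → Desc d u → ¬ Desc w' u
    inside du dw'u = diverging-subtrees-disjoint A p p' d≢d' du (desc-trans p' (∈-++⁺ʳ A (here refl)) dw'u)

    outside : ∀ {u} → ¬ Desc d u → ¬ Desc w u
    outside ¬du dwu = ¬du (desc-trans p (∈-++⁺ʳ A (here refl)) dwu)

    -- A neighbour v ∉ D(d) of D(d) lies in X or on A, so ρ and ρ' agree at v,
    -- and v is outside D(w').
    boundary : ∀ {u v} → Desc d u → ¬ Desc d v → adj G u v ≡ true → ρ v ≡ ρ' v × ¬ Desc w' v
    boundary {u} {v} du ¬dv uv with v ∈ₛ? X
    ... | yes v∈X = agree-X v v∈X , λ (v∉X , _) → v∉X v∈X
    ... | no v∉X with exit-to-ancestor (path-prefix A p) du ¬dv v∉X uv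
    ...   | v∈Pd , v≢d with ∈-++⁻ A v∈Pd
    ...     | inj₁ v∈A         = agree-A v∈A , ancestor-not-desc A p' v∈A
    ...     | inj₂ (here v≡d)  = ⊥-elim (v≢d v≡d)

    crossing-proper : ∀ {u v} → Desc d u → ¬ Desc d v → adj G u v ≡ true → ρ' u ≢ ρ v
    crossing-proper {u} {v} du ¬dv uv ρ'u≡ρv with boundary du ¬dv uv
    ... | ρv≡ρ'v , ¬dw'v = proper' u v (inside du) ¬dw'v uv (trans ρ'u≡ρv ρv≡ρ'v)

    ψ-proper : ∀ u v → adj G u v ≡ true → ψ u ≢ ψ v
    ψ-proper u v uv with desc? d u | desc? d v
    ... | yes du | yes dv = proper' u v (inside du) (inside dv) uv
    ... | no ¬du | no ¬dv = proper u v (outside ¬du) (outside ¬dv) uv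
    ... | yes du | no ¬dv = crossing-proper du ¬dv uv
    ... | no ¬du | yes dv = crossing-proper dv ¬du (trans (adj-sym G v u) uv) ∘ sym

  exchange : ∀ {M w w' P P'} {ρ ρ' : Fin n → Fin M} → ¬ Colorable M (whole G) → w ≢ w' →
             Path ET t0 w P → Path ET t0 w' P' → length P ≡ length P' →
             ProperOutside w ρ → ProperOutside w' ρ' → (∀ x → x ∈ₛ X → ρ x ≡ ρ' x) →
             AgreeAlong ρ ρ' P P' → ⊥
  exchange {w' = w'} {P} {P'} not-col w≢w' p p' |P|≡|P'| proper proper' agree-X agree
    with first-divergence _≟_ P P' |P|≡|P'|
           (λ P≡P' → w≢w' (walk-end-determined (proj₁ p) (subst (Walk ET t0 w') (sym P≡P') (proj₁ p'))))
  ... | A , d , R , d' , R' , refl , refl , d≢d' = not-col ((λ u _ → ψ u) , λ u v _ _ → ψ-proper u v)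
    where open Glue A p p' d≢d' proper proper' agree-X (agree-before-divergence A agree)

unique-lookup-injective : ∀ {A : Set} {L : List A} → Unique L → ∀ {i j} → lookup L i ≡ lookup L j → i ≡ j
unique-lookup-injective     (_ ∷ _)    {zero}  {zero}  _ = refl
unique-lookup-injective {L = _ ∷ L} (x∉ ∷ _) {zero}  {suc j} e = ⊥-elim (All.lookup x∉ (∈-lookup {xs = L} j) e)
unique-lookup-injective {L = _ ∷ L} (x∉ ∷ _) {suc i} {zero}  e = ⊥-elim (All.lookup x∉ (∈-lookup {xs = L} i) (sym e))
unique-lookup-injective     (_ ∷ u)    {suc i} {suc j} e = cong suc (unique-lookup-injective u e)

count-by-code : ∀ {A : Set} {P : A → Set} {N} (L : List A) → Unique L → All P L →
                (code : ∀ {x} → P x → Fin N) →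
                (∀ {x y} (px : P x) (py : P y) → code px ≡ code py → x ≡ y) → length L ≤ N
count-by-code L unique all-P code code-determines =
  injective⇒≤ {f = λ i → code (All.lookup all-P (∈-lookup i))}
              (λ e → unique-lookup-injective unique (code-determines _ _ e))

transpose-injective : ∀ {m} (a b : Fin m) {x y} → transpose a b x ≡ transpose a b y → x ≡ y
transpose-injective a b {x} {y} e = begin
  x                                 ≡⟨ sym (transpose-inverse b a) ⟩
  transpose b a (transpose a b x)   ≡⟨ cong (transpose b a) e ⟩
  transpose b a (transpose a b y)   ≡⟨ transpose-inverse b a ⟩
  y                                 ∎
  where open ≡-Reasoning

transpose-first : ∀ {m} (a b : Fin m) → transpose a b a ≡ b
transpose-first a b rewrite dec-true (a ≟ a) refl = refl

transpose-other : ∀ {m} (a b x : Fin m) → x ≢ a → x ≢ b → transpose a b x ≡ x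
transpose-other a b x x≢a x≢b rewrite dec-false (x ≟ a) x≢a | dec-false (x ≟ b) x≢b = refl

normalise₂ : ∀ {m} → Fin (suc (suc m)) → Fin (suc (suc m)) → Fin (suc (suc m)) → Fin (suc (suc m))
normalise₂ a b = transpose (transpose a zero b) (suc zero) ∘ transpose a zero

normalise₂-injective : ∀ {m} (a b : Fin (suc (suc m))) {x y} → normalise₂ a b x ≡ normalise₂ a b y → x ≡ y
normalise₂-injective a b = transpose-injective a zero ∘ transpose-injective (transpose a zero b) (suc zero)

normalise₂-first : ∀ {m} (a b : Fin (suc (suc m))) → a ≢ b → normalise₂ a b a ≡ zero
normalise₂-first {m} a b a≢b = begin
  transpose b' (suc zero) (transpose a zero a) ≡⟨ cong (transpose b' (suc zero)) (transpose-first a zero) ⟩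
  transpose b' (suc zero) zero                 ≡⟨ transpose-other b' (suc zero) zero 0≢b' (λ ()) ⟩
  zero                                         ∎
  where
  open ≡-Reasoning
  b' : Fin (suc (suc m))
  b' = transpose a zero b
  0≢b' : zero ≢ b'
  0≢b' 0≡b' = a≢b (transpose-injective a zero (trans (transpose-first a zero) 0≡b'))

normalise₂-second : ∀ {m} (a b : Fin (suc (suc m))) → normalise₂ a b b ≡ suc zero
normalise₂-second a b = transpose-first (transpose a zero b) (suc zero)

restriction-code : ∀ {n M} (X : Subset n) → (Fin n → Fin M) → Fin (M ^ ∣ X ∣)
restriction-code []          ρ = zero
restriction-code (true ∷ X)  ρ = combine (ρ zero) (restriction-code X (ρ ∘ suc))
restriction-code (false ∷ X) ρ = restriction-code X (ρ ∘ suc)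

restriction-code-injective : ∀ {n M} (X : Subset n) (ρ ρ' : Fin n → Fin M) →
  restriction-code X ρ ≡ restriction-code X ρ' → ∀ x → x ∈ₛ X → ρ x ≡ ρ' x
restriction-code-injective (true ∷ X) ρ ρ' e zero _ =
  proj₁ (combine-injective (ρ zero) _ (ρ' zero) _ e)
restriction-code-injective (true ∷ X) ρ ρ' e (suc x) (thereᵥ x∈X) =
  restriction-code-injective X (ρ ∘ suc) (ρ' ∘ suc) (proj₂ (combine-injective (ρ zero) _ (ρ' zero) _ e)) x x∈X
restriction-code-injective (false ∷ X) ρ ρ' e (suc x) (thereᵥ x∈X) =
  restriction-code-injective X (ρ ∘ suc) (ρ' ∘ suc) e x x∈X

-- A colour b ≢ a coded relative to a, using one colour fewer.
relative-colour : ∀ {K} → Fin (suc (suc K)) → Fin (suc (suc K)) → Fin (suc K)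
relative-colour a b with a ≟ b
... | yes _  = zero
... | no a≢b = punchOut a≢b

relative-colour-injective : ∀ {K} (a b b' : Fin (suc (suc K))) → a ≢ b → a ≢ b' →
                            relative-colour a b ≡ relative-colour a b' → b ≡ b'
relative-colour-injective a b b' a≢b a≢b' e with a ≟ b | a ≟ b'
... | yes a≡b | _        = ⊥-elim (a≢b a≡b)
... | no _    | yes a≡b' = ⊥-elim (a≢b' a≡b')
... | no a≢b  | no a≢b'  = punchOut-injective a≢b a≢b' e

ProperAlong : ∀ {V : Set} {M} → (V → Fin M) → V → List V → Set
ProperAlong ρ a (b ∷ c ∷ l) = ρ a ≢ ρ b × ProperAlong ρ b (c ∷ l)
ProperAlong ρ a _           = ⊤

path-code : ∀ {V : Set} {K} → (V → Fin (suc (suc K))) → V → (l : List V) → (r : ℕ) →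
            length l ≡ suc r → Fin (suc K ^ r)
path-code ρ a (b ∷ [])    zero    _ = zero
path-code ρ a (b ∷ c ∷ l) (suc r) e = combine (relative-colour (ρ a) (ρ b)) (path-code ρ b (c ∷ l) r (suc-injective e))
path-code ρ a (b ∷ [])    (suc r) ()
path-code ρ a (b ∷ c ∷ l) zero    ()

path-code-injective : ∀ {V : Set} {K} (ρ ρ' : V → Fin (suc (suc K))) a a' l l' r e e' →
  ρ a ≡ ρ' a' → ProperAlong ρ a l → ProperAlong ρ' a' l' →
  path-code ρ a l r e ≡ path-code ρ' a' l' r e' → AgreeAlong ρ ρ' (a ∷ l) (a' ∷ l')
path-code-injective ρ ρ' a a' (b ∷ []) (b' ∷ []) zero _ _ ρa≡ρ'a' _ _ _ = ρa≡ρ'a' , tt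
path-code-injective ρ ρ' a a' (b ∷ c ∷ l) (b' ∷ c' ∷ l') (suc r) e e' ρa≡ρ'a'
                    (ρa≢ρb , proper) (ρ'a'≢ρ'b' , proper') codes≡
  with combine-injective _ _ _ _ codes≡
... | first≡ , rest≡ =
  ρa≡ρ'a' , path-code-injective ρ ρ' b b' (c ∷ l) (c' ∷ l') r _ _ ρb≡ρ'b' proper proper' rest≡
  where
  ρb≡ρ'b' : ρ b ≡ ρ' b'
  ρb≡ρ'b' = relative-colour-injective (ρ' a') (ρ b) (ρ' b') (ρa≢ρb ∘ trans ρa≡ρ'a') ρ'a'≢ρ'b'
              (trans (cong (λ z → relative-colour z (ρ b)) (sym ρa≡ρ'a')) first≡)
path-code-injective ρ ρ' a a' (b ∷ [])    (b' ∷ c' ∷ l') zero    _  () _ _ _ _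
path-code-injective ρ ρ' a a' (b ∷ c ∷ l) (b' ∷ [])      zero    () _  _ _ _ _
path-code-injective ρ ρ' a a' (b ∷ [])    _              (suc r) () _  _ _ _ _
path-code-injective ρ ρ' a a' (b ∷ c ∷ l) (b' ∷ [])      (suc r) _  () _ _ _ _

module Bounds {n : ℕ} (G : Graph n) (X : Subset n) (ET : Fin n → Fin n → Bool) (t0 : Fin n)
              (dfs-tree : DFSTree G X ET t0) where

  open Exchange G X ET t0 dfs-tree

  ∧-true : ∀ {a b} → a ≡ true → b ≡ true → a ∧ b ≡ true
  ∧-true refl refl = refl

  ∧-true⁻ : ∀ a {b} → a ∧ b ≡ true → a ≡ true × b ≡ true
  ∧-true⁻ true b≡true = refl , b≡true

  in-G-D : Fin n → Fin n → Bool
  in-G-D w u = not (does (desc? w u))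

  in-G-D-true : ∀ {w u} → ¬ Desc w u → in-G-D w u ≡ true
  in-G-D-true {w} {u} ¬du = cong not (dec-false (desc? w u) ¬du)

  remove-subtree : Fin n → Subgraph G
  remove-subtree w = record
    { V     = in-G-D w
    ; E     = λ u v → adj G u v ∧ (in-G-D w u ∧ in-G-D w v)
    ; E-sym = λ u v → cong₂ _∧_ (adj-sym G u v) (∧-comm (in-G-D w u) (in-G-D w v))
    ; E⊆    = λ u v e → proj₁ (∧-true⁻ (adj G u v) e)
    ; E-V   = λ u v e → ∧-true⁻ (in-G-D w u) (proj₂ (∧-true⁻ (adj G u v) e)) }

  remove-subtree-proper : ∀ {w P} → Path ET t0 w P → Proper (remove-subtree w)
  remove-subtree-proper {w} p = inj₁ (w , cong not (dec-true (desc? w w) (desc-self p)))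

  extend : ∀ {M} b → (b ≡ true → Fin (suc M)) → Fin (suc M)
  extend true  c = c refl
  extend false _ = zero

  extend-true : ∀ {M b} (c : b ≡ true → Fin (suc M)) (e : b ≡ true) → extend b c ≡ c e
  extend-true c refl = refl

  colouring-outside : ∀ {M w} → Colorable (suc M) (remove-subtree w) →
                      Σ (Fin n → Fin (suc M)) (ProperOutside w)
  colouring-outside {M} {w} (c , c-proper) = ρ , ρ-proper
    where
    ρ : Fin n → Fin (suc M)
    ρ u = extend (in-G-D w u) (c u)
    ρ-proper : ProperOutside w ρ
    ρ-proper u v ¬du ¬dv uv ρu≡ρv =
      c-proper u v (in-G-D-true ¬du) (in-G-D-true ¬dv) (∧-true uv (∧-true (in-G-D-true ¬du) (in-G-D-true ¬dv)))
        (trans (sym (extend-true (c u) _)) (trans ρu≡ρv (extend-true (c v) _)))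

  relabel : ∀ {M w} {ρ : Fin n → Fin M} (σ : Fin M → Fin M) → (∀ {x y} → σ x ≡ σ y → x ≡ y) →
            ProperOutside w ρ → ProperOutside w (σ ∘ ρ)
  relabel σ σ-injective proper u v ¬du ¬dv uv = proper u v ¬du ¬dv uv ∘ σ-injective

  -- All vertices of the root path of w but w itself are outside D(w), so a
  -- colouring proper outside D(w) is proper along that path (last edge excluded).
  proper-along-root-path : ∀ {M w} {ρ : Fin n → Fin M} B a l → Path ET t0 w (B ++ a ∷ l) →
                           ProperOutside w ρ → ProperAlong ρ a l
  proper-along-root-path B a []          _ _ = tt
  proper-along-root-path B a (b ∷ [])    _ _ = tt
  proper-along-root-path {w = w} B a (b ∷ c ∷ l) p proper =
    proper a b (not-desc (∈-++⁺ʳ B (here refl))) (not-desc (∈-++⁺ʳ B (there (here refl))))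
           (tree-edge-in-G B (proj₁ p)) ,
    proper-along-root-path (B ++ [ a ]) b (c ∷ l)
      (subst (Path ET t0 w) (sym (++-assoc B [ a ] (b ∷ c ∷ l))) p) proper
    where
    not-desc : ∀ {v} → v ∈ B ++ a ∷ b ∷ [] → ¬ Desc w v
    not-desc = ancestor-not-desc (B ++ a ∷ b ∷ [])
                 (subst (Path ET t0 w) (sym (++-assoc B (a ∷ b ∷ []) (c ∷ l))) p)

  DepthView : ℕ → Fin n → Set
  DepthView j w = ∃[ t1 ] ∃[ rest ] (Path ET t0 w (t0 ∷ t1 ∷ rest) × length rest ≡ j)

  depth-view : ∀ {j w} → AtDist ET t0 (suc j) w → DepthView j w
  depth-view ((_ ∷ t1 ∷ rest) , p , |P|≡) with walk-head (proj₁ p)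
  ... | refl = t1 , rest , p , suc-injective (suc-injective |P|≡)

  -- t0 lies in G − D(w), so a critical graph needs a colour for it; at depth
  -- ≥ 2 the adjacent vertices t0, t1 both lie in G − D(w) and need two colours.
  no-colouring-with-0 : ∀ {j w} → (∀ (H : Subgraph G) → Proper H → Colorable 0 H) → AtDist ET t0 (suc j) w → ⊥
  no-colouring-with-0 col at with depth-view at
  ... | t1 , rest , p , _ =
    ¬Fin0 (proj₁ (col (remove-subtree _) (remove-subtree-proper p)) t0 (in-G-D-true (ancestor-not-desc [ t0 ] p (here refl))))

  no-colouring-with-1 : ∀ {j w} → (∀ (H : Subgraph G) → Proper H → Colorable 1 H) → AtDist ET t0 (suc (suc j)) w → ⊥
  no-colouring-with-1 {w = w} col at with depth-view at
  ... | t1 , d ∷ rest , p , _ with col (remove-subtree _) (remove-subtree-proper p)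
  ...   | c , c-proper = c-proper t0 t1 in₀ in₁ (∧-true (tree-edge-in-G [] (proj₁ p)) (∧-true in₀ in₁))
                           (Fin1-unique _ _)
    where
    Fin1-unique : (x y : Fin 1) → x ≡ y
    Fin1-unique zero zero = refl
    in₀ : in-G-D w t0 ≡ true
    in₀ = in-G-D-true (ancestor-not-desc (t0 ∷ t1 ∷ []) p (here refl))
    in₁ : in-G-D w t1 ≡ true
    in₁ = in-G-D-true (ancestor-not-desc (t0 ∷ t1 ∷ []) p (there (here refl)))

  -- Depth 1: a vertex w is certified by a colouring of G − D(w) normalised
  -- to colour t0 with 0; its restriction to X determines w.
  module DepthOne {m : ℕ} (not-colourable : ¬ Colorable (suc m) (whole G))
                  (colour : ∀ (H : Subgraph G) → Proper H → Colorable (suc m) H) where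

    record Certificate (w : Fin n) : Set where
      field
        t1        : Fin n
        path      : Path ET t0 w (t0 ∷ t1 ∷ [])
        ρ         : Fin n → Fin (suc m)
        proper    : ProperOutside w ρ
        root-zero : ρ t0 ≡ zero

    certificate : ∀ {w} → AtDist ET t0 1 w → Certificate w
    certificate at with depth-view at
    ... | t1 , [] , p , _ with colouring-outside (colour (remove-subtree _) (remove-subtree-proper p))
    ...   | ρ , proper = record
      { t1 = t1 ; path = p
      ; ρ = transpose (ρ t0) zero ∘ ρ
      ; proper = relabel _ (transpose-injective (ρ t0) zero) proper
      ; root-zero = transpose-first (ρ t0) zero }

    code : ∀ {w} → AtDist ET t0 1 w → Fin (suc m ^ ∣ X ∣)
    code at = restriction-code X (Certificate.ρ (certificate at))

    code-determines : ∀ {w w'} (at : AtDist ET t0 1 w) (at' : AtDist ET t0 1 w') →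
                      code at ≡ code at' → w ≡ w'
    code-determines {w} {w'} at at' codes≡ with w ≟ w'
    ... | yes w≡w' = w≡w'
    ... | no w≢w'  = ⊥-elim (exchange not-colourable w≢w' path path' refl proper proper'
                               (restriction-code-injective X ρ ρ' codes≡)
                               (trans root-zero (sym root-zero') , tt))
      where
      open Certificate (certificate at)
      open Certificate (certificate at') using ()
        renaming (path to path'; ρ to ρ'; proper to proper'; root-zero to root-zero')

    bound : (L : List (Fin n)) → Unique L → All (AtDist ET t0 1) L → length L ≤ suc m ^ ∣ X ∣
    bound L unique at-depth = count-by-code L unique at-depth code code-determines

  -- Depth j + 2: normalise to colour t0, t1 with 0, 1; the colours of X and
  -- of the remaining coloured path vertices (each ≠ its predecessor) determine w.
  module Deep {m : ℕ} (not-colourable : ¬ Colorable (suc (suc m)) (whole G))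
              (colour : ∀ (H : Subgraph G) → Proper H → Colorable (suc (suc m)) H) (j : ℕ) where

    record Certificate (w : Fin n) : Set where
      field
        t1        : Fin n
        rest      : List (Fin n)
        path      : Path ET t0 w (t0 ∷ t1 ∷ rest)
        depth     : length rest ≡ suc j
        ρ         : Fin n → Fin (suc (suc m))
        proper    : ProperOutside w ρ
        root-zero : ρ t0 ≡ zero
        t1-one    : ρ t1 ≡ suc zero

    certificate : ∀ {w} → AtDist ET t0 (suc (suc j)) w → Certificate w
    certificate at with depth-view at
    ... | t1 , rest@(_ ∷ _) , p , |rest| with colouring-outside (colour (remove-subtree _) (remove-subtree-proper p))
    ...   | ρ , proper = record
      { t1 = t1 ; rest = rest ; path = p ; depth = |rest|
      ; ρ = normalise₂ (ρ t0) (ρ t1) ∘ ρ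
      ; proper = relabel _ (normalise₂-injective (ρ t0) (ρ t1)) proper
      ; root-zero = normalise₂-first (ρ t0) (ρ t1) (proj₁ (proper-along-root-path [] t0 (t1 ∷ rest) p proper))
      ; t1-one = normalise₂-second (ρ t0) (ρ t1) }

    code : ∀ {w} → AtDist ET t0 (suc (suc j)) w → Fin (suc m ^ j * suc (suc m) ^ ∣ X ∣)
    code at = combine (path-code ρ t1 rest j depth) (restriction-code X ρ)
      where open Certificate (certificate at)

    code-determines : ∀ {w w'} (at : AtDist ET t0 (suc (suc j)) w) (at' : AtDist ET t0 (suc (suc j)) w') →
                      code at ≡ code at' → w ≡ w'
    code-determines {w} {w'} at at' codes≡ with w ≟ w' | combine-injective _ _ _ _ codes≡
    ... | yes w≡w' | _ = w≡w'
    ... | no w≢w'  | path-codes≡ , X-codes≡ =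
      ⊥-elim (exchange not-colourable w≢w' path path'
                (cong (λ (r : ℕ) → suc (suc r)) (trans depth (sym depth'))) proper proper'
                (restriction-code-injective X ρ ρ' X-codes≡)
                (trans root-zero (sym root-zero') , along))
      where
      open Certificate (certificate at)
      open Certificate (certificate at') using ()
        renaming (t1 to t1'; rest to rest'; path to path'; depth to depth'; ρ to ρ';
                  proper to proper'; root-zero to root-zero'; t1-one to t1-one')
      along : AgreeAlong ρ ρ' (t1 ∷ rest) (t1' ∷ rest')
      along = path-code-injective ρ ρ' t1 t1' rest rest' j depth depth' (trans t1-one (sym t1-one'))
                (proper-along-root-path [ t0 ] t1 rest path proper)
                (proper-along-root-path [ t0 ] t1' rest' path' proper') path-codes≡

    bound : (L : List (Fin n)) → Unique L → All (AtDist ET t0 (suc (suc j))) L →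
            length L ≤ suc m ^ j * suc (suc m) ^ ∣ X ∣
    bound L unique at-depth = count-by-code L unique at-depth code code-determines

  depth-one-bound : ∀ k → Critical k G → (L : List (Fin n)) → Unique L →
                    All (AtDist ET t0 1) L → length L ≤ (k ∸ 1) ^ ∣ X ∣
  depth-one-bound _             _                     []      _      _        = z≤n
  depth-one-bound zero          (_ , colour)          (_ ∷ _) _      (at ∷ _) = ⊥-elim (no-colouring-with-0 colour at)
  depth-one-bound (suc zero)    (_ , colour)          (_ ∷ _) _      (at ∷ _) = ⊥-elim (no-colouring-with-0 colour at)
  depth-one-bound (suc (suc m)) (not-colourable , colour) L   unique at-depth =
    DepthOne.bound not-colourable colour L unique at-depth

  deep-bound : ∀ k j → Critical k G → (L : List (Fin n)) → Unique L →
               All (AtDist ET t0 (suc (suc j))) L → length L ≤ (k ∸ 2) ^ j * (k ∸ 1) ^ ∣ X ∣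
  deep-bound _ _                   _                     []      _      _        = z≤n
  deep-bound zero             _    (_ , colour)          (_ ∷ _) _      (at ∷ _) = ⊥-elim (no-colouring-with-0 colour at)
  deep-bound (suc zero)       _    (_ , colour)          (_ ∷ _) _      (at ∷ _) = ⊥-elim (no-colouring-with-0 colour at)
  deep-bound (suc (suc zero)) _    (_ , colour)          (_ ∷ _) _      (at ∷ _) = ⊥-elim (no-colouring-with-1 colour at)
  deep-bound (suc (suc (suc m))) j (not-colourable , colour) L  unique at-depth =
    Deep.bound not-colourable colour j L unique at-depth

lemma2p1 : (k n s : ℕ) → 1 ≤ k → (G : Graph n) → Critical k G →
    (X : Subset n) → ∣ X ∣ ≡ s →
    (ET : Fin n → Fin n → Bool) (t0 : Fin n) → DFSTree G X ET t0 →
    (j : ℕ) → 1 ≤ j →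
    (L : List (Fin n)) → Unique L → All (AtDist ET t0 j) L →
    (j ≡ 1 → length L ≤ (k ∸ 1) ^ s) ×
    (2 ≤ j → length L ≤ (k ∸ 2) ^ (j ∸ 2) * (k ∸ 1) ^ s)
lemma2p1 k n .(∣ X ∣) _ G critical X refl ET t0 dfs-tree (suc zero) _ L unique at-depth =
  (λ _ → depth-one-bound k critical L unique at-depth) , λ { (s≤s ()) }
  where open Bounds G X ET t0 dfs-tree
lemma2p1 k n .(∣ X ∣) _ G critical X refl ET t0 dfs-tree (suc (suc j)) _ L unique at-depth =
  (λ ()) , λ _ → deep-bound k j critical L unique at-depth
  where open Bounds G X ET t0 dfs-tree
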